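{- Let $m\geq 3$. Then the graph $\mathrm{Cay}(\mathbb{Z}_m\times\mathbb{Z}_{16},\ \{\pm1\}\times\{\pm6\})\cup mI_{12}'\cup mI_{13}'\cup mI_{14}'\cup mI_{15}'$ can be decomposed into four $C_{16}$-factors.
   Context: For a finite additive group $\Gamma$ and $S\subseteq\Gamma\setminus\{0\}$ closed under negatives, $\mathrm{Cay}(\Gamma,S)$ has vertex set $\Gamma$ and an edge between $a,b$ whenever $a-b\in S$; here $S=\{(\epsilon,\delta):\epsilon\in\{1,-1\},\delta\in\{6,-6\}\}\subseteq \mathbb{Z}_m\times\mathbb{Z}_{16}$. The following are perfect matchings of $K_{16}$ on vertex set $\mathbb{Z}_{16}$: $I_{12}'=\{(0,1),(7,2),(12,4),(10,3),(13,5),(11,14),(8,9),(15,6)\}$, $I_{13}'=\{(6,7),(13,8),(2,10),(0,9),(3,11),(1,4),(14,15),(5,12)\}$, $I_{14}'=\{(0,3),(13,1),(7,4),(14,2),(8,11),(5,6),(12,15),(9,10)\}$, $I_{15}'=\{(10,13),(7,11),(1,14),(8,12),(2,5),(15,0),(6,9),(3,4)\}$. For such a matching $I$, $mI$ denotes the graph with vertex set $\mathbb{Z}_m\times\mathbb{Z}_{16}$ and edge set $\{\{(j,a),(j,b)\}: j\in\mathbb{Z}_m,\ (a,b)\in I\}$. The union of graphs on the same vertex set has the union of their edge sets. A $C_{16}$-factor is a spanning subgraph each of whose components is a 16-cycle; decomposing means partitioning the edge set into these factors. -}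

module Defs where

open import Data.Nat using (ℕ; suc; _+_; _∸_; NonZero)
open import Data.Nat.DivMod using (_mod_)
open import Data.Fin using (Fin; toℕ)
open import Data.Product using (_×_; _,_; Σ; ∃; proj₁; proj₂)
open import Data.Sum using (_⊎_)
open import Data.List using (List; _∷_; [])
open import Data.List.Membership.Propositional using (_∈_)
open import Relation.Binary.PropositionalEquality using (_≡_)
open import Function.Bundles using (_⇔_)

-- ℤ_n represented by Fin n, with arithmetic modulo n.
infixl 6 _⊕_ _⊖_
_⊕_ : {n : ℕ} .{{_ : NonZero n}} → Fin n → Fin n → Fin n
_⊕_ {n} a b = (toℕ a + toℕ b) mod n

⊝_ : {n : ℕ} .{{_ : NonZero n}} → Fin n → Fin n
⊝_ {n} a = (n ∸ toℕ a) mod n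

_⊖_ : {n : ℕ} .{{_ : NonZero n}} → Fin n → Fin n → Fin n
a ⊖ b = a ⊕ (⊝ b)

[_]ₙ : {n : ℕ} .{{_ : NonZero n}} → ℕ → Fin n
[_]ₙ {n} k = k mod n

V : ℕ → Set
V m = Fin m × Fin 16

-- Graphs on a fixed vertex set, given by their (symmetric) adjacency relation.
Graph : Set → Set₁
Graph A = A → A → Set

_−ᵥ_ : {m : ℕ} .{{_ : NonZero m}} → V m → V m → V m
(i , a) −ᵥ (j , b) = (i ⊖ j , a ⊖ b)

Cay : (m : ℕ) .{{_ : NonZero m}} → (V m → Set) → Graph (V m)
Cay m S x y = S (x −ᵥ y)

S : (m : ℕ) .{{_ : NonZero m}} → V m → Set
S m (e , d) = (e ≡ [ 1 ]ₙ ⊎ e ≡ ⊝ [ 1 ]ₙ) × (d ≡ [ 6 ]ₙ ⊎ d ≡ ⊝ [ 6 ]ₙ)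

-- A matching on ℤ_16 given as a list of pairs (a,b), read as unordered edges.
Matching : Set
Matching = List (Fin 16 × Fin 16)

mI : (m : ℕ) → Matching → Graph (V m)
mI m I (j , a) (j' , b) = j ≡ j' × ((a , b) ∈ I ⊎ (b , a) ∈ I)

_∪_ : {A : Set} → Graph A → Graph A → Graph A
(G ∪ H) x y = G x y ⊎ H x y
infixl 5 _∪_

f : {n : ℕ} .{{_ : NonZero n}} → ℕ → Fin n
f k = [ k ]ₙ

I12' I13' I14' I15' : Matching
I12' = (f 0 , f 1) ∷ (f 7 , f 2) ∷ (f 12 , f 4) ∷ (f 10 , f 3) ∷ (f 13 , f 5) ∷ (f 11 , f 14) ∷ (f 8 , f 9) ∷ (f 15 , f 6) ∷ []
I13' = (f 6 , f 7) ∷ (f 13 , f 8) ∷ (f 2 , f 10) ∷ (f 0 , f 9) ∷ (f 3 , f 11) ∷ (f 1 , f 4) ∷ (f 14 , f 15) ∷ (f 5 , f 12) ∷ []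
I14' = (f 0 , f 3) ∷ (f 13 , f 1) ∷ (f 7 , f 4) ∷ (f 14 , f 2) ∷ (f 8 , f 11) ∷ (f 5 , f 6) ∷ (f 12 , f 15) ∷ (f 9 , f 10) ∷ []
I15' = (f 10 , f 13) ∷ (f 7 , f 11) ∷ (f 1 , f 14) ∷ (f 8 , f 12) ∷ (f 2 , f 5) ∷ (f 15 , f 0) ∷ (f 6 , f 9) ∷ (f 3 , f 4) ∷ []

G : (m : ℕ) .{{_ : NonZero m}} → Graph (V m)
G m = Cay m (S m) ∪ mI m I12' ∪ mI m I13' ∪ mI m I14' ∪ mI m I15'

next : Fin 16 → Fin 16
next i = i ⊕ [ 1 ]ₙ

-- A 16-cycle in a vertex set A: 16 distinct vertices listed cyclically.
record Cycle16 (A : Set) : Set where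
  field
    vert      : Fin 16 → A
    injective : ∀ i j → vert i ≡ vert j → i ≡ j

CycleEdge : {A : Set} → Cycle16 A → A → A → Set
CycleEdge C x y =
  ∃ λ i → (x ≡ Cycle16.vert C i × y ≡ Cycle16.vert C (next i))
        ⊎ (y ≡ Cycle16.vert C i × x ≡ Cycle16.vert C (next i))

-- F is a C₁₆-factor (of the complete graph on A): F is a spanning graph whose
-- components are 16-cycles, i.e. F is the edge-union of a family of
-- vertex-disjoint 16-cycles covering every vertex.
record C16Factor (A : Set) (F : Graph A) : Set where
  field
    r        : ℕ
    cycle    : Fin r → Cycle16 A
    covers   : ∀ v → ∃ λ k → ∃ λ i → Cycle16.vert (cycle k) i ≡ v
    disjoint : ∀ k k' i i' → Cycle16.vert (cycle k) i ≡ Cycle16.vert (cycle k') i' → k ≡ k'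
    edges    : ∀ x y → F x y ⇔ (∃ λ k → CycleEdge (cycle k) x y)

record C16Decomposition (A : Set) (G : Graph A) (t : ℕ) : Set₁ where
  field
    factor     : Fin t → Graph A
    isFactor   : ∀ c → C16Factor A (factor c)
    covers     : ∀ x y → G x y → ∃ λ c → factor c x y
    sub        : ∀ c x y → factor c x y → G x y
    disjoint   : ∀ c c' x y → factor c x y → factor c' x y → c ≡ c'

-- Each colour c is a Hamiltonian cycle (tour) of K₁₆ on ℤ₁₆ together with the height pattern
-- 0,0,1,1,0,0,1,1,… on its positions. Placing position i of the tour on level j + height i of
-- ℤₘ × ℤ₁₆ gives, for every j, a 16-cycle on the levels j and j + 1; these m cycles form a
-- C₁₆-factor. A step of the tour between equal heights is then an edge of mI_c, a step between
-- different heights an edge of the Cayley graph. For m ≥ 3 an edge of ℤₘ × ℤ₁₆ determines the step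
-- of ℤ₁₆ it lies over together with its slope (flat, up or down), so the four factors decompose
-- the graph as soon as finitely many facts about the four tours hold: their flat steps are exactly
-- the pairs of the I_c, their sloped steps have difference ±6 and cover every such arc in both
-- slopes, and no step occurs in two tours. These facts are decided by computation.
module Submission where

open import Defs
open import Data.Nat using (ℕ; s≤s; z≤n; _+_; _∸_; _≤_; _<_; _%_; _≤?_; NonZero; >-nonZero⁻¹)
open import Data.Nat.Properties using (+-comm; +-assoc; +-identityʳ; m+[n∸m]≡n; <⇒≤; <⇒≢; ≤-trans)
open import Data.Nat.DivMod using (%-distribˡ-+; m%n%n≡m%n; m%n<n; m<n⇒m%n≡m; n%n≡0)
open import Data.Fin using (Fin; toℕ; zero; suc; _≟_)
open import Data.Fin.Properties using (toℕ-injective; toℕ-fromℕ<; toℕ<n; all?; any?)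
open import Data.Vec using (Vec; lookup; _∷_; [])
open import Data.Bool using (Bool; true; false)
open import Data.Product using (_×_; _,_; ∃; ∃₂; proj₁; proj₂)
open import Data.Product.Properties using (≡-dec)
open import Data.Sum using (_⊎_; inj₁; inj₂)
open import Data.List.Membership.Propositional using (_∈_)
open import Data.List.Membership.DecPropositional (≡-dec (_≟_ {16}) (_≟_ {16})) using (_∈?_)
open import Data.List.Relation.Unary.All using (All) renaming (lookup to All-lookup; all? to All-all?)
open import Data.Empty using (⊥-elim)
open import Algebra.Bundles using (AbelianGroup)
open import Algebra.Structures using (IsAbelianGroup)
import Algebra.Properties.Group as GroupProperties
open import Level using (0ℓ)
open import Relation.Nullary using (Dec; yes; no)
open import Relation.Nullary.Decidable using (toWitness; ⌊_⌋; _⊎-dec_; _×-dec_; _→-dec_)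
open import Relation.Binary.Definitions using (DecidableEquality)
open import Relation.Binary.PropositionalEquality
open import Function.Bundles using (mk⇔)
open import Function using (id)

module _ {n : ℕ} .{{_ : NonZero n}} where

  toℕ-[]ₙ : ∀ k → toℕ ([_]ₙ {n} k) ≡ k % n
  toℕ-[]ₙ k = toℕ-fromℕ< (m%n<n k n)

  toℕ-[<n]ₙ : ∀ {k} → k < n → toℕ ([_]ₙ {n} k) ≡ k
  toℕ-[<n]ₙ k<n = trans (toℕ-[]ₙ _) (m<n⇒m%n≡m k<n)

  toℕ-[0]ₙ : toℕ ([_]ₙ {n} 0) ≡ 0
  toℕ-[0]ₙ = toℕ-[<n]ₙ (>-nonZero⁻¹ n)

  [x%n+y]%n≡[x+y]%n : ∀ x y → (x % n + y) % n ≡ (x + y) % n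
  [x%n+y]%n≡[x+y]%n x y = begin
    (x % n + y) % n          ≡⟨ %-distribˡ-+ (x % n) y n ⟩
    (x % n % n + y % n) % n  ≡⟨ cong (λ t → (t + y % n) % n) (m%n%n≡m%n x n) ⟩
    (x % n + y % n) % n      ≡⟨ %-distribˡ-+ x y n ⟨
    (x + y) % n              ∎
    where open ≡-Reasoning

  [x+y%n]%n≡[x+y]%n : ∀ x y → (x + y % n) % n ≡ (x + y) % n
  [x+y%n]%n≡[x+y]%n x y = begin
    (x + y % n) % n  ≡⟨ cong (_% n) (+-comm x (y % n)) ⟩
    (y % n + x) % n  ≡⟨ [x%n+y]%n≡[x+y]%n y x ⟩
    (y + x) % n      ≡⟨ cong (_% n) (+-comm y x) ⟩
    (x + y) % n      ∎
    where open ≡-Reasoning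

  ⊕-comm : ∀ (a b : Fin n) → a ⊕ b ≡ b ⊕ a
  ⊕-comm a b = cong [_]ₙ (+-comm (toℕ a) (toℕ b))

  ⊕-assoc : ∀ (a b c : Fin n) → (a ⊕ b) ⊕ c ≡ a ⊕ (b ⊕ c)
  ⊕-assoc a b c = toℕ-injective (begin
    toℕ ((a ⊕ b) ⊕ c)                  ≡⟨ toℕ-[]ₙ _ ⟩
    (toℕ (a ⊕ b) + toℕ c) % n          ≡⟨ cong (λ t → (t + toℕ c) % n) (toℕ-[]ₙ _) ⟩
    ((toℕ a + toℕ b) % n + toℕ c) % n  ≡⟨ [x%n+y]%n≡[x+y]%n _ _ ⟩
    (toℕ a + toℕ b + toℕ c) % n        ≡⟨ cong (_% n) (+-assoc (toℕ a) (toℕ b) (toℕ c)) ⟩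
    (toℕ a + (toℕ b + toℕ c)) % n      ≡⟨ [x+y%n]%n≡[x+y]%n _ _ ⟨
    (toℕ a + (toℕ b + toℕ c) % n) % n  ≡⟨ cong (λ t → (toℕ a + t) % n) (toℕ-[]ₙ _) ⟨
    (toℕ a + toℕ (b ⊕ c)) % n          ≡⟨ toℕ-[]ₙ _ ⟨
    toℕ (a ⊕ (b ⊕ c))                  ∎)
    where open ≡-Reasoning

  ⊕-identityʳ : ∀ (a : Fin n) → a ⊕ [ 0 ]ₙ ≡ a
  ⊕-identityʳ a = toℕ-injective (begin
    toℕ (a ⊕ [ 0 ]ₙ)                ≡⟨ toℕ-[]ₙ _ ⟩
    (toℕ a + toℕ ([_]ₙ {n} 0)) % n  ≡⟨ cong (λ t → (toℕ a + t) % n) (toℕ-[]ₙ 0) ⟩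
    (toℕ a + 0 % n) % n             ≡⟨ [x+y%n]%n≡[x+y]%n _ 0 ⟩
    (toℕ a + 0) % n                 ≡⟨ cong (_% n) (+-identityʳ (toℕ a)) ⟩
    toℕ a % n                       ≡⟨ m<n⇒m%n≡m (toℕ<n a) ⟩
    toℕ a                           ∎)
    where open ≡-Reasoning

  ⊕-inverseʳ : ∀ (a : Fin n) → a ⊕ ⊝ a ≡ [ 0 ]ₙ
  ⊕-inverseʳ a = toℕ-injective (begin
    toℕ (a ⊕ ⊝ a)                  ≡⟨ toℕ-[]ₙ _ ⟩
    (toℕ a + toℕ (⊝ a)) % n        ≡⟨ cong (λ t → (toℕ a + t) % n) (toℕ-[]ₙ _) ⟩
    (toℕ a + (n ∸ toℕ a) % n) % n  ≡⟨ [x+y%n]%n≡[x+y]%n _ _ ⟩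
    (toℕ a + (n ∸ toℕ a)) % n      ≡⟨ cong (_% n) (m+[n∸m]≡n (<⇒≤ (toℕ<n a))) ⟩
    n % n                          ≡⟨ n%n≡0 n ⟩
    0                              ≡⟨ toℕ-[0]ₙ ⟨
    toℕ ([_]ₙ {n} 0)               ∎)
    where open ≡-Reasoning

  ℤₙ-isAbelianGroup : IsAbelianGroup _≡_ (_⊕_ {n}) [ 0 ]ₙ ⊝_
  ℤₙ-isAbelianGroup = record
    { isGroup = record
      { isMonoid = record
        { isSemigroup = record
          { isMagma = record { isEquivalence = isEquivalence ; ∙-cong = cong₂ _⊕_ }
          ; assoc = ⊕-assoc
          }
        ; identity = (λ a → trans (⊕-comm _ a) (⊕-identityʳ a)) , ⊕-identityʳ
        }
      ; inverse = (λ a → trans (⊕-comm _ a) (⊕-inverseʳ a)) , ⊕-inverseʳ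
      ; ⁻¹-cong = cong ⊝_
      }
    ; comm = ⊕-comm
    }

  ℤₙ : AbelianGroup 0ℓ 0ℓ
  ℤₙ = record { isAbelianGroup = ℤₙ-isAbelianGroup }

  open GroupProperties (AbelianGroup.group ℤₙ) public
    using (//-rightDividesˡ; //-rightDividesʳ; ∙-cancelʳ; identityʳ-unique; ⁻¹-anti-homo-//; ⁻¹-involutive)

  [j]ₙ⊕[k]ₙ≡[j+k]ₙ : ∀ j k → [_]ₙ {n} j ⊕ [ k ]ₙ ≡ [ j + k ]ₙ
  [j]ₙ⊕[k]ₙ≡[j+k]ₙ j k = toℕ-injective (begin
    toℕ ([ j ]ₙ ⊕ [ k ]ₙ)                    ≡⟨ toℕ-[]ₙ _ ⟩
    (toℕ ([_]ₙ {n} j) + toℕ ([_]ₙ {n} k)) % n  ≡⟨ cong₂ (λ x y → (x + y) % n) (toℕ-[]ₙ j) (toℕ-[]ₙ k) ⟩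
    (j % n + k % n) % n                      ≡⟨ %-distribˡ-+ j k n ⟨
    (j + k) % n                              ≡⟨ toℕ-[]ₙ _ ⟨
    toℕ ([_]ₙ {n} (j + k))                   ∎)
    where open ≡-Reasoning

  a⊕[k]ₙ≢a : ∀ {k} → 0 < k → k < n → ∀ (a : Fin n) → a ⊕ [ k ]ₙ ≢ a
  a⊕[k]ₙ≢a {k} 0<k k<n a eq = <⇒≢ 0<k (sym (begin
    k                ≡⟨ toℕ-[<n]ₙ k<n ⟨
    toℕ [ k ]ₙ       ≡⟨ cong toℕ (identityʳ-unique a _ eq) ⟩
    toℕ ([_]ₙ {n} 0) ≡⟨ toℕ-[0]ₙ ⟩
    0                ∎))
    where open ≡-Reasoning

  ⊖≡⇒≡⊕ : ∀ {a b c : Fin n} → a ⊖ b ≡ c → a ≡ b ⊕ c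
  ⊖≡⇒≡⊕ {a} {b} refl = trans (sym (//-rightDividesˡ b a)) (⊕-comm _ b)

  [a⊕b]⊖a≡b : ∀ (a b : Fin n) → (a ⊕ b) ⊖ a ≡ b
  [a⊕b]⊖a≡b a b = trans (cong (_⊖ a) (⊕-comm a b)) (//-rightDividesʳ a b)

  ⊖≡⊝⇒⊖-swap≡ : ∀ (a b c : Fin n) → a ⊖ b ≡ ⊝ c → b ⊖ a ≡ c
  ⊖≡⊝⇒⊖-swap≡ a b c eq = begin
    b ⊖ a      ≡⟨ ⁻¹-anti-homo-// a b ⟨
    ⊝ (a ⊖ b)  ≡⟨ cong ⊝_ eq ⟩
    ⊝ ⊝ c      ≡⟨ ⁻¹-involutive c ⟩
    c          ∎
    where open ≡-Reasoning

data Slope : Set where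
  flat up down : Slope

reverseˢ : Slope → Slope
reverseˢ flat = flat
reverseˢ up = down
reverseˢ down = up

slope : Bool → Bool → Slope
slope false true = up
slope true false = down
slope _ _ = flat

_≟ˢ_ : DecidableEquality Slope
flat ≟ˢ flat = yes refl
up ≟ˢ up = yes refl
down ≟ˢ down = yes refl
flat ≟ˢ up = no λ ()
flat ≟ˢ down = no λ ()
up ≟ˢ flat = no λ ()
up ≟ˢ down = no λ ()
down ≟ˢ flat = no λ ()
down ≟ˢ up = no λ ()

module _ {n : ℕ} .{{_ : NonZero n}} where

  _+ᵇ_ : Fin n → Bool → Fin n
  k +ᵇ false = k
  k +ᵇ true = k ⊕ [ 1 ]ₙ

  _-ᵇ_ : Fin n → Bool → Fin n
  l -ᵇ false = l
  l -ᵇ true = l ⊖ [ 1 ]ₙ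

  -ᵇ+ᵇ : ∀ l b → (l -ᵇ b) +ᵇ b ≡ l
  -ᵇ+ᵇ l false = refl
  -ᵇ+ᵇ l true = //-rightDividesˡ [ 1 ]ₙ l

  +ᵇ-cancelʳ : ∀ b {k k'} → k +ᵇ b ≡ k' +ᵇ b → k ≡ k'
  +ᵇ-cancelʳ false eq = eq
  +ᵇ-cancelʳ true eq = ∙-cancelʳ [ 1 ]ₙ _ _ eq

  Climb : Slope → Fin n → Fin n → Set
  Climb flat l l' = l ≡ l'
  Climb up l l' = l' ≡ l ⊕ [ 1 ]ₙ
  Climb down l l' = l ≡ l' ⊕ [ 1 ]ₙ

  climb-reverse : ∀ d {l l'} → Climb d l l' → Climb (reverseˢ d) l' l
  climb-reverse flat = sym
  climb-reverse up = id
  climb-reverse down = id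

  climb-slope : ∀ k b b' → Climb (slope b b') (k +ᵇ b) (k +ᵇ b')
  climb-slope k false false = refl
  climb-slope k false true = refl
  climb-slope k true false = refl
  climb-slope k true true = refl

  climb-slope⁻¹ : ∀ k b b' {l'} → Climb (slope b b') (k +ᵇ b) l' → l' ≡ k +ᵇ b'
  climb-slope⁻¹ k false false = sym
  climb-slope⁻¹ k false true = id
  climb-slope⁻¹ k true false eq = sym (∙-cancelʳ [ 1 ]ₙ _ _ eq)
  climb-slope⁻¹ k true true = sym

  ⊖≡1⇒climb-down : ∀ {l l'} → l ⊖ l' ≡ [ 1 ]ₙ → Climb down l l'
  ⊖≡1⇒climb-down = ⊖≡⇒≡⊕

  ⊖≡-1⇒climb-up : ∀ {l l'} → l ⊖ l' ≡ ⊝ [ 1 ]ₙ → Climb up l l'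
  ⊖≡-1⇒climb-up {l} {l'} eq = ⊖≡⇒≡⊕ (⊖≡⊝⇒⊖-swap≡ l l' [ 1 ]ₙ eq)

  climb-down⇒⊖≡1 : ∀ {l l'} → Climb down l l' → l ⊖ l' ≡ [ 1 ]ₙ
  climb-down⇒⊖≡1 {_} {l'} refl = [a⊕b]⊖a≡b l' [ 1 ]ₙ

  climb-up⇒⊖≡-1 : ∀ {l l'} → Climb up l l' → l ⊖ l' ≡ ⊝ [ 1 ]ₙ
  climb-up⇒⊖≡-1 {l} refl = trans (sym (⁻¹-anti-homo-// (l ⊕ [ 1 ]ₙ) l)) (cong ⊝_ ([a⊕b]⊖a≡b l [ 1 ]ₙ))

  -- The slope of a step is visible in the levels only if 1 and 2 are nonzero modulo n.
  climb-unique : 3 ≤ n → ∀ d d' {l l'} → Climb d l l' → Climb d' l l' → d ≡ d'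
  climb-unique 3≤n = unique
    where
    a⊕1≢a : ∀ a → a ⊕ [ 1 ]ₙ ≢ a
    a⊕1≢a = a⊕[k]ₙ≢a (s≤s z≤n) (≤-trans (s≤s (s≤s z≤n)) 3≤n)

    a⊕1⊕1≢a : ∀ a → a ⊕ [ 1 ]ₙ ⊕ [ 1 ]ₙ ≢ a
    a⊕1⊕1≢a a eq = a⊕[k]ₙ≢a (s≤s z≤n) 3≤n a
      (trans (cong (a ⊕_) (sym ([j]ₙ⊕[k]ₙ≡[j+k]ₙ 1 1))) (trans (sym (⊕-assoc a _ _)) eq))

    unique : ∀ d d' {l l'} → Climb d l l' → Climb d' l l' → d ≡ d'
    unique flat flat _ _ = refl
    unique up up _ _ = refl
    unique down down _ _ = refl
    unique flat up refl e = ⊥-elim (a⊕1≢a _ (sym e))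
    unique up flat e refl = ⊥-elim (a⊕1≢a _ (sym e))
    unique flat down refl e = ⊥-elim (a⊕1≢a _ (sym e))
    unique down flat e refl = ⊥-elim (a⊕1≢a _ (sym e))
    unique up down refl e = ⊥-elim (a⊕1⊕1≢a _ (sym e))
    unique down up refl e = ⊥-elim (a⊕1⊕1≢a _ (sym e))

Step : Set
Step = Fin 16 × Fin 16 × Slope

reverse : Step → Step
reverse (a , b , d) = b , a , reverseˢ d

reverse-involutive : ∀ s → reverse (reverse s) ≡ s
reverse-involutive (a , b , flat) = refl
reverse-involutive (a , b , up) = refl
reverse-involutive (a , b , down) = refl

_≟ˢᵗ_ : DecidableEquality Step
_≟ˢᵗ_ = ≡-dec _≟_ (≡-dec _≟_ _≟ˢ_)

module _ {m : ℕ} .{{_ : NonZero m}} where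

  Realises : V m → V m → Step → Set
  Realises (l , u) (l' , v) (a , b , d) = u ≡ a × v ≡ b × Climb d l l'

  realises-reverse : ∀ {x y} s → Realises x y s → Realises y x (reverse s)
  realises-reverse (a , b , d) (u≡a , v≡b , c) = v≡b , u≡a , climb-reverse d c

  realises-unique : 3 ≤ m → ∀ {x y} s s' → Realises x y s → Realises x y s' → s ≡ s'
  realises-unique 3≤m (a , b , d) (a' , b' , d') (refl , refl , c) (refl , refl , c') =
    cong (λ d → a , b , d) (climb-unique 3≤m d d' c c')

step : (Fin 16 → Fin 16) → (Fin 16 → Bool) → Fin 16 → Step
step P h i = P i , P (next i) , slope (h i) (h (next i))

IsStep : (Fin 16 → Fin 16) → (Fin 16 → Bool) → Step → Fin 16 → Set
IsStep P h s i = step P h i ≡ s ⊎ reverse (step P h i) ≡ s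

isStep? : ∀ P h s i → Dec (IsStep P h s i)
isStep? P h s i = (step P h i ≟ˢᵗ s) ⊎-dec (reverse (step P h i) ≟ˢᵗ s)

isStep-reverse : ∀ P h s {i} → IsStep P h s i → IsStep P h (reverse s) i
isStep-reverse P h s (inj₁ refl) = inj₂ refl
isStep-reverse P h s (inj₂ refl) = inj₁ (sym (reverse-involutive _))

module Lift {m : ℕ} .{{_ : NonZero m}}
            (P : Fin 16 → Fin 16) (P-injective : ∀ i j → P i ≡ P j → i ≡ j)
            (h : Fin 16 → Bool) where

  vertex : Fin m → Fin 16 → V m
  vertex k i = k +ᵇ h i , P i

  cycle : Fin m → Cycle16 (V m)
  cycle k = record { vert = vertex k ; injective = λ i j eq → P-injective i j (cong proj₂ eq) }

  Edge : Graph (V m)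
  Edge x y = ∃ λ k → CycleEdge (cycle k) x y

  edge-sym : ∀ {x y} → Edge x y → Edge y x
  edge-sym (k , i , inj₁ e) = k , i , inj₂ e
  edge-sym (k , i , inj₂ e) = k , i , inj₁ e

  isC16Factor : (∀ a → ∃ λ i → P i ≡ a) → C16Factor (V m) Edge
  isC16Factor P-surjective = record
    { r = m
    ; cycle = cycle
    ; covers = covers
    ; disjoint = disjoint
    ; edges = λ _ _ → mk⇔ id id
    }
    where
    covers : ∀ v → ∃ λ k → ∃ λ i → vertex k i ≡ v
    covers (l , a) with P-surjective a
    ... | i , refl = l -ᵇ h i , i , cong (_, P i) (-ᵇ+ᵇ l (h i))

    disjoint : ∀ k k' i i' → vertex k i ≡ vertex k' i' → k ≡ k'
    disjoint k k' i i' eq with P-injective i i' (cong proj₂ eq)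
    ... | refl = +ᵇ-cancelʳ (h i) (cong proj₁ eq)

  edge⇒step : ∀ {x y} → Edge x y → ∃₂ λ s i → Realises x y s × IsStep P h s i
  edge⇒step (k , i , inj₁ (refl , refl)) =
    step P h i , i , (refl , refl , climb-slope k (h i) (h (next i))) , inj₁ refl
  edge⇒step (k , i , inj₂ (refl , refl)) =
    reverse (step P h i) , i ,
    realises-reverse (step P h i) (refl , refl , climb-slope k (h i) (h (next i))) , inj₂ refl

  realised-step⇒edge : ∀ {x y} i → Realises x y (step P h i) → Edge x y
  realised-step⇒edge {l , _} {l' , _} i (refl , refl , c) =
    k , i , inj₁ (cong (_, P i) (sym (-ᵇ+ᵇ l (h i))) ,
                  cong (_, P (next i)) (climb-slope⁻¹ k (h i) (h (next i)) c′))
    where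
    k = l -ᵇ h i
    c′ : Climb (slope (h i) (h (next i))) (k +ᵇ h i) l'
    c′ = subst (λ l → Climb _ l l') (sym (-ᵇ+ᵇ l (h i))) c

  step⇒edge : ∀ {x y} s i → Realises x y s → IsStep P h s i → Edge x y
  step⇒edge _ i r (inj₁ refl) = realised-step⇒edge i r
  step⇒edge {x} {y} s i r (inj₂ refl) =
    edge-sym (realised-step⇒edge i (subst (Realises y x) (reverse-involutive _) (realises-reverse s r)))

-- Tour c runs through the pairs of I c at its even positions and through differences ±6 at its
-- odd positions.
tourTable : Fin 4 → Vec ℕ 16
tourTable zero = 0 ∷ 1 ∷ 7 ∷ 2 ∷ 12 ∷ 4 ∷ 10 ∷ 3 ∷ 13 ∷ 5 ∷ 11 ∷ 14 ∷ 8 ∷ 9 ∷ 15 ∷ 6 ∷ []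
tourTable (suc zero) = 2 ∷ 10 ∷ 0 ∷ 9 ∷ 3 ∷ 11 ∷ 1 ∷ 4 ∷ 14 ∷ 15 ∷ 5 ∷ 12 ∷ 6 ∷ 7 ∷ 13 ∷ 8 ∷ []
tourTable (suc (suc zero)) = 0 ∷ 3 ∷ 13 ∷ 1 ∷ 7 ∷ 4 ∷ 14 ∷ 2 ∷ 8 ∷ 11 ∷ 5 ∷ 6 ∷ 12 ∷ 15 ∷ 9 ∷ 10 ∷ []
tourTable (suc (suc (suc zero))) = 1 ∷ 14 ∷ 8 ∷ 12 ∷ 2 ∷ 5 ∷ 15 ∷ 0 ∷ 6 ∷ 9 ∷ 3 ∷ 4 ∷ 10 ∷ 13 ∷ 7 ∷ 11 ∷ []

tour : Fin 4 → Fin 16 → Fin 16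
tour c i = [ lookup (tourTable c) i ]ₙ

raised : Fin 16 → Bool
raised i = ⌊ 2 ≤? toℕ i % 4 ⌋

I : Fin 4 → Matching
I zero = I12'
I (suc zero) = I13'
I (suc (suc zero)) = I14'
I (suc (suc (suc zero))) = I15'

stepOf : Fin 4 → Fin 16 → Step
stepOf c = step (tour c) raised

StepOf : Fin 4 → Step → Fin 16 → Set
StepOf c = IsStep (tour c) raised

FlatStepOf : Fin 4 → Fin 16 × Fin 16 → Set
FlatStepOf c (a , b) = ∃ λ i → StepOf c (a , b , flat) i

Arc : Fin 16 → Fin 16 → Set
Arc a b = a ⊖ b ≡ [ 6 ]ₙ ⊎ a ⊖ b ≡ ⊝ [ 6 ]ₙ

arc? : ∀ a b → Dec (Arc a b)
arc? a b = (a ⊖ b ≟ [ 6 ]ₙ) ⊎-dec (a ⊖ b ≟ ⊝ [ 6 ]ₙ)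

Admissible : Fin 4 → Step → Set
Admissible c (a , b , flat) = (a , b) ∈ I c ⊎ (b , a) ∈ I c
Admissible c (a , b , up) = Arc a b
Admissible c (a , b , down) = Arc a b

admissible? : ∀ c s → Dec (Admissible c s)
admissible? c (a , b , flat) = ((a , b) ∈? I c) ⊎-dec ((b , a) ∈? I c)
admissible? c (a , b , up) = arc? a b
admissible? c (a , b , down) = arc? a b

-- abstract keeps the decision procedures from being unfolded when later definitions are checked.
abstract
  tour-injective : ∀ c i j → tour c i ≡ tour c j → i ≡ j
  tour-injective = toWitness {a? = all? λ c → all? λ i → all? λ j → (tour c i ≟ tour c j) →-dec (i ≟ j)} _

  tour-surjective : ∀ c a → ∃ λ i → tour c i ≡ a
  tour-surjective = toWitness {a? = all? λ c → all? λ a → any? λ i → tour c i ≟ a} _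

  steps-admissible : ∀ c i → Admissible c (stepOf c i) × Admissible c (reverse (stepOf c i))
  steps-admissible = toWitness {a? = all? λ c → all? λ i →
    admissible? c (stepOf c i) ×-dec admissible? c (reverse (stepOf c i))} _

  matching-edges-are-steps : ∀ c → All (FlatStepOf c) (I c)
  matching-edges-are-steps = toWitness {a? = all? λ c → All-all? (λ p → any? λ i →
    isStep? (tour c) raised (proj₁ p , proj₂ p , flat) i) (I c)} _

  arcs-are-steps : ∀ a b → Arc a b →
                   (∃₂ λ c i → StepOf c (a , b , up) i) × (∃₂ λ c i → StepOf c (a , b , down) i)
  arcs-are-steps = toWitness {a? = all? λ a → all? λ b → arc? a b →-dec
    ((any? λ c → any? λ i → isStep? (tour c) raised (a , b , up) i) ×-dec
     (any? λ c → any? λ i → isStep? (tour c) raised (a , b , down) i))} _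

  steps-disjoint : ∀ c i c' i' → StepOf c' (stepOf c i) i' → c ≡ c'
  steps-disjoint = toWitness {a? = all? λ c → all? λ i → all? λ c' → all? λ i' →
    isStep? (tour c') raised (stepOf c i) i' →-dec (c ≟ c')} _

module _ {m : ℕ} .{{_ : NonZero m}} where

  module Colour (c : Fin 4) = Lift {m} (tour c) (tour-injective c) raised

  factor : Fin 4 → Graph (V m)
  factor = Colour.Edge

  matching⇒G : ∀ c {x y} → mI m (I c) x y → G m x y
  matching⇒G zero e = inj₁ (inj₁ (inj₁ (inj₂ e)))
  matching⇒G (suc zero) e = inj₁ (inj₁ (inj₂ e))
  matching⇒G (suc (suc zero)) e = inj₁ (inj₂ e)
  matching⇒G (suc (suc (suc zero))) e = inj₂ e

  admissible⇒G : ∀ c {x y} s → Admissible c s → Realises x y s → G m x y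
  admissible⇒G c (a , b , flat) e (refl , refl , refl) = matching⇒G c (refl , e)
  admissible⇒G c (a , b , up) arc (refl , refl , cl) = inj₁ (inj₁ (inj₁ (inj₁ (inj₂ (climb-up⇒⊖≡-1 cl) , arc))))
  admissible⇒G c (a , b , down) arc (refl , refl , cl) = inj₁ (inj₁ (inj₁ (inj₁ (inj₁ (climb-down⇒⊖≡1 cl) , arc))))

  factor⊆G : ∀ c {x y} → factor c x y → G m x y
  factor⊆G c e with Colour.edge⇒step c e
  ... | s , i , r , inj₁ refl = admissible⇒G c s (proj₁ (steps-admissible c i)) r
  ... | s , i , r , inj₂ refl = admissible⇒G c s (proj₂ (steps-admissible c i)) r

  matching⇒step : ∀ c {x y} → mI m (I c) x y → ∃₂ λ s i → Realises x y s × StepOf c s i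
  matching⇒step c {_ , a} {_ , b} (refl , inj₁ ab∈I) =
    let i , st = All-lookup (matching-edges-are-steps c) ab∈I
    in (a , b , flat) , i , (refl , refl , refl) , st
  matching⇒step c {_ , a} {_ , b} (refl , inj₂ ba∈I) =
    let i , st = All-lookup (matching-edges-are-steps c) ba∈I
    in (a , b , flat) , i , (refl , refl , refl) , isStep-reverse (tour c) raised (b , a , flat) st

  G⇒step : ∀ {x y} → G m x y → ∃ λ c → ∃₂ λ s i → Realises x y s × StepOf c s i
  G⇒step {l , a} {l' , b} (inj₁ (inj₁ (inj₁ (inj₁ (inj₁ l⊖l'≡1 , arc))))) =
    let c , i , st = proj₂ (arcs-are-steps a b arc)
    in c , (a , b , down) , i , (refl , refl , ⊖≡1⇒climb-down l⊖l'≡1) , st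
  G⇒step {l , a} {l' , b} (inj₁ (inj₁ (inj₁ (inj₁ (inj₂ l⊖l'≡-1 , arc))))) =
    let c , i , st = proj₁ (arcs-are-steps a b arc)
    in c , (a , b , up) , i , (refl , refl , ⊖≡-1⇒climb-up l⊖l'≡-1) , st
  G⇒step (inj₁ (inj₁ (inj₁ (inj₂ e)))) = zero , matching⇒step zero e
  G⇒step (inj₁ (inj₁ (inj₂ e))) = suc zero , matching⇒step (suc zero) e
  G⇒step (inj₁ (inj₂ e)) = suc (suc zero) , matching⇒step (suc (suc zero)) e
  G⇒step (inj₂ e) = suc (suc (suc zero)) , matching⇒step (suc (suc (suc zero))) e

  G⊆factors : ∀ {x y} → G m x y → ∃ λ c → factor c x y
  G⊆factors e with G⇒step e
  ... | c , s , i , r , st = c , Colour.step⇒edge c s i r st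

  factors-disjoint : 3 ≤ m → ∀ c c' {x y} → factor c x y → factor c' x y → c ≡ c'
  factors-disjoint 3≤m c c' e e'
    with Colour.edge⇒step c e | Colour.edge⇒step c' e'
  ... | s , i , r , st | s' , i' , r' , st' with realises-unique 3≤m s s' r r'
  ... | refl = steps-disjoint c i c' i' (same-edge st st')
    where
    same-edge : ∀ {s} → StepOf c s i → StepOf c' s i' → StepOf c' (stepOf c i) i'
    same-edge (inj₁ refl) st' = st'
    same-edge (inj₂ refl) st' =
      subst (λ t → StepOf c' t i') (reverse-involutive _) (isStep-reverse (tour c') raised _ st')

lemma2p13 : (m : ℕ) .{{_ : NonZero m}} → 3 ≤ m → C16Decomposition (V m) (G m) 4
lemma2p13 m 3≤m = record
  { factor = factor
  ; isFactor = λ c → Colour.isC16Factor c (tour-surjective c)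
  ; covers = λ _ _ → G⊆factors
  ; sub = λ c _ _ → factor⊆G c
  ; disjoint = λ c c' _ _ → factors-disjoint 3≤m c c'
  }
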